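{- Let $\mathcal{G}$ be a Cayley graph $\mathrm{Cay}(G,S)$ of an abelian group $G$ with respect to a (possibly infinite) generating subset $S$. If $\mathcal{G}$ contains a geodesic ray, then $\mathcal{G}$ contains a bi-infinite geodesic path, i.e. a geodesic path defined on all of $\mathbb{Z}$.
   Context: A graph is a pair $(V,E)$ with $E$ a set of 2-element subsets of $V$, connected and non-empty, not necessarily locally finite. $\mathrm{Cay}(G,S)$ has vertex set $G$, two distinct vertices $g,h$ being adjacent iff $g^{ -1}h\in S\cup S^{ -1}$. A path is a map $\kappa:I\to V$ with $I\subseteq\mathbb{Z}$ a non-empty integer interval and $\{\kappa(n),\kappa(n+1)\}\in E$ whenever $n,n+1\in I$; it is geodesic if $d(\kappa(m),\kappa(n))=|m-n|$ for all $m,n\in I$, where $d$ is the graph distance. A ray is a path with domain $\mathbb{N}$; a path is bi-infinite if its domain is $\mathbb{Z}$. -}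

module Defs where

open import Level using (Level; _⊔_)
open import Data.Nat as ℕ using (ℕ; zero; suc; ∣_-_∣)
open import Data.Integer as ℤ using (ℤ)
open import Data.Sum using (_⊎_)
open import Data.Product using (Σ; _×_)
open import Relation.Nullary using (¬_)
open import Relation.Binary using (_Respects_)
open import Algebra.Bundles using (AbelianGroup)

-- Cayley graph Cay(G,S) of an abelian group G (carrier a setoid; the group
-- is the quotient by _≈_) with respect to a subset S (a predicate on the carrier
-- respecting _≈_).
module Cayley {c ℓ p : Level} (G : AbelianGroup c ℓ)
              (S : AbelianGroup.Carrier G → Set p) where
  open AbelianGroup G

  data Generated : Carrier → Set (c ⊔ ℓ ⊔ p) where
    gen-ε    : ∀ {g} → g ≈ ε → Generated g
    gen-cons : ∀ {g s h} → Generated g → S s →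
               (h ≈ g ∙ s) ⊎ (h ≈ g ∙ (s ⁻¹)) → Generated h

  Generating : Set (c ⊔ ℓ ⊔ p)
  Generating = (S Respects _≈_) × (∀ g → Generated g)

  Adj : Carrier → Carrier → Set (ℓ ⊔ p)
  Adj g h = (¬ (g ≈ h)) × (S ((g ⁻¹) ∙ h) ⊎ S (((g ⁻¹) ∙ h) ⁻¹))

  data Walk : Carrier → Carrier → ℕ → Set (c ⊔ ℓ ⊔ p) where
    w-nil  : ∀ {x y} → x ≈ y → Walk x y zero
    w-cons : ∀ {x y z k} → Adj x y → Walk y z k → Walk x z (suc k)

  Dist : Carrier → Carrier → ℕ → Set (c ⊔ ℓ ⊔ p)
  Dist x y k = Walk x y k × (∀ j → Walk x y j → k ℕ.≤ j)

  GeodesicRay : (ℕ → Carrier) → Set (c ⊔ ℓ ⊔ p)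
  GeodesicRay κ = (∀ n → Adj (κ n) (κ (suc n)))
                × (∀ m n → Dist (κ m) (κ n) ∣ m - n ∣)

  BiInfiniteGeodesic : (ℤ → Carrier) → Set (c ⊔ ℓ ⊔ p)
  BiInfiniteGeodesic κ = (∀ n → Adj (κ n) (κ (n ℤ.+ ℤ.1ℤ)))
                       × (∀ m n → Dist (κ m) (κ n) ℤ.∣ m ℤ.- n ∣)

-- Let d₀, d₁, d₂, … be the successive increments κ(i)⁻¹κ(i+1) of the geodesic
-- ray κ.  Walk forwards along the even increments and backwards along the odd
-- ones: η(n) = d₀d₂⋯d₂ₙ₋₂ and η(-p) = (d₁d₃⋯d₂ₚ₋₁)⁻¹.  Since G is abelian, the
-- displacement η(i)⁻¹η(j) is a product of |i - j| distinct increments among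
-- d₀, …, d_{2N-1} for N large, and multiplying in the remaining 2N - |i - j|
-- of them gives κ(0)⁻¹κ(2N), whose length is 2N.  A path from η(i) to η(j) shorter
-- than |i - j| would therefore yield a path from κ(0) to κ(2N) shorter than 2N.

module Submission where

open import Defs
open import Level using (Level)
open import Function using (_∘_)
open import Data.Nat as ℕ using (ℕ; zero; suc; _+_)
import Data.Nat.Properties as ℕ
open import Data.Nat.Tactic.RingSolver as ℕ-Solver using ()
open import Data.Integer as ℤ using (ℤ; -[1+_]; _⊖_; +≤+; -≤-; -≤+)
import Data.Integer.Properties as ℤ
open import Data.Integer.Tactic.RingSolver as ℤ-Solver using ()
open import Data.Product using (Σ; _,_; proj₁; proj₂)
open import Data.Sum as Sum using (inj₁; inj₂)
open import Relation.Binary using (_Respects_)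
open import Relation.Binary.PropositionalEquality as ≡ using (_≡_)
open import Algebra.Bundles using (AbelianGroup; Group)

twice : ℕ → ℕ
twice zero    = zero
twice (suc n) = suc (suc (twice n))

twice≡+ : ∀ n → twice n ≡ n + n
twice≡+ zero    = ≡.refl
twice≡+ (suc n) = ≡.cong suc (≡.trans (≡.cong suc (twice≡+ n)) (≡.sym (ℕ.+-suc n n)))

k+[a+[a+k]]≡[a+k]+[a+k] : ∀ a k → k + (a + (a + k)) ≡ (a + k) + (a + k)
k+[a+[a+k]]≡[a+k]+[a+k] = ℕ-Solver.solve-∀

k+[[a+k]+a]≡[a+k]+[a+k] : ∀ a k → k + ((a + k) + a) ≡ (a + k) + (a + k)
k+[[a+k]+a]≡[a+k]+[a+k] = ℕ-Solver.solve-∀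

i-[i+1]≡-1 : ∀ i → i ℤ.- (i ℤ.+ ℤ.1ℤ) ≡ ℤ.-1ℤ
i-[i+1]≡-1 = ℤ-Solver.solve-∀

∣m+n⊖m∣≡n : ∀ m n → ℤ.∣ (m + n) ⊖ m ∣ ≡ n
∣m+n⊖m∣≡n m n = ≡.trans (≡.cong ℤ.∣_∣ (ℤ.⊖-≥ (ℕ.m≤m+n m n))) (ℕ.m+n∸m≡n m n)

∣+[m+n]-+m∣≡n : ∀ m n → ℤ.∣ ℤ.+ (m + n) ℤ.- ℤ.+ m ∣ ≡ n
∣+[m+n]-+m∣≡n m n = ≡.trans (≡.cong ℤ.∣_∣ (ℤ.[+m]-[+n]≡m⊖n (m + n) m)) (∣m+n⊖m∣≡n m n)

∣-[1+m]--[1+m+n]∣≡n : ∀ m n → ℤ.∣ -[1+ m ] ℤ.- -[1+ m + n ] ∣ ≡ n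
∣-[1+m]--[1+m+n]∣≡n m n = ≡.trans (≡.cong ℤ.∣_∣ (ℤ.[1+m]⊖[1+n]≡m⊖n (m + n) m)) (∣m+n⊖m∣≡n m n)

module Abelian {c ℓ : Level} (G : AbelianGroup c ℓ) where
  open AbelianGroup G
  open Group group using (_\\_; _//_)
  open import Algebra.Properties.AbelianGroup G
  open import Algebra.Properties.CommutativeSemigroup commutativeSemigroup
    using (interchange; x∙yz≈y∙xz; x∙yz≈y∙zx; x∙yz≈yx∙z)
  open import Relation.Binary.Reasoning.Setoid setoid

  [xy]⁻¹∙y≈x⁻¹ : ∀ x y → (x ∙ y) ⁻¹ ∙ y ≈ x ⁻¹
  [xy]⁻¹∙y≈x⁻¹ x y = begin
    (x ∙ y) ⁻¹ ∙ y       ≈⟨ ∙-congʳ (⁻¹-∙-comm x y) ⟨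
    (x ⁻¹ ∙ y ⁻¹) ∙ y    ≈⟨ assoc _ _ _ ⟩
    x ⁻¹ ∙ (y ⁻¹ ∙ y)    ≈⟨ ∙-congˡ (inverseˡ y) ⟩
    x ⁻¹ ∙ ε             ≈⟨ identityʳ _ ⟩
    x ⁻¹                 ∎

  [gx]\\[gy]≈x\\y : ∀ g x y → (g ∙ x) \\ (g ∙ y) ≈ x \\ y
  [gx]\\[gy]≈x\\y g x y = begin
    (g ∙ x) ⁻¹ ∙ (g ∙ y)        ≈⟨ ∙-congʳ (⁻¹-anti-homo-∙ g x) ⟩
    (x ⁻¹ ∙ g ⁻¹) ∙ (g ∙ y)     ≈⟨ assoc _ _ _ ⟩
    x ⁻¹ ∙ (g ⁻¹ ∙ (g ∙ y))     ≈⟨ ∙-congˡ (\\-leftDividesʳ g y) ⟩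
    x ⁻¹ ∙ y                    ∎

  ∏ : (ℕ → Carrier) → ℕ → Carrier
  ∏ u zero    = ε
  ∏ u (suc k) = u 0 ∙ ∏ (u ∘ suc) k

  ∏-+ : ∀ u a b → ∏ u (a + b) ≈ ∏ u a ∙ ∏ (u ∘ (a +_)) b
  ∏-+ u zero    b = sym (identityˡ _)
  ∏-+ u (suc a) b = begin
    u 0 ∙ ∏ (u ∘ suc) (a + b)                        ≈⟨ ∙-congˡ (∏-+ (u ∘ suc) a b) ⟩
    u 0 ∙ (∏ (u ∘ suc) a ∙ ∏ (u ∘ suc ∘ (a +_)) b)   ≈⟨ assoc _ _ _ ⟨
    (u 0 ∙ ∏ (u ∘ suc) a) ∙ ∏ (u ∘ suc ∘ (a +_)) b   ∎

  ∏-interleave : ∀ u k → ∏ u (twice k) ≈ ∏ (u ∘ twice) k ∙ ∏ (u ∘ suc ∘ twice) k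
  ∏-interleave u zero    = sym (identityˡ ε)
  ∏-interleave u (suc k) = begin
    u 0 ∙ (u 1 ∙ ∏ (u ∘ suc ∘ suc) (twice k))  ≈⟨ ∙-congˡ (∙-congˡ (∏-interleave (u ∘ suc ∘ suc) k)) ⟩
    u 0 ∙ (u 1 ∙ (evens ∙ odds))                ≈⟨ ∙-congˡ (x∙yz≈y∙xz _ _ _) ⟩
    u 0 ∙ (evens ∙ (u 1 ∙ odds))                ≈⟨ assoc _ _ _ ⟨
    (u 0 ∙ evens) ∙ (u 1 ∙ odds)                ∎
    where
    evens = ∏ (u ∘ twice ∘ suc) k
    odds  = ∏ (u ∘ suc ∘ twice ∘ suc) k

  increments : (ℕ → Carrier) → ℕ → Carrier
  increments κ i = κ i \\ κ (suc i)

  ∏-increments : ∀ κ k → κ 0 ∙ ∏ (increments κ) k ≈ κ k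
  ∏-increments κ zero    = identityʳ _
  ∏-increments κ (suc k) = begin
    κ 0 ∙ ((κ 0 \\ κ 1) ∙ ∏ (increments (κ ∘ suc)) k) ≈⟨ assoc _ _ _ ⟨
    (κ 0 ∙ (κ 0 \\ κ 1)) ∙ ∏ (increments (κ ∘ suc)) k ≈⟨ ∙-congʳ (\\-leftDividesˡ (κ 0) (κ 1)) ⟩
    κ 1 ∙ ∏ (increments (κ ∘ suc)) k                  ≈⟨ ∏-increments (κ ∘ suc) k ⟩
    κ (suc k)                                         ∎

  module CayleyGraph {p : Level} (S : Carrier → Set p) (S-resp : S Respects _≈_) where
    open Cayley G S

    adj-transport : ∀ {x y x′ y′} → (x′ ≈ y′ → x ≈ y) → x \\ y ≈ x′ \\ y′ →
                    Adj x y → Adj x′ y′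
    adj-transport reflect e (x≉y , s) =
      x≉y ∘ reflect , Sum.map (S-resp e) (S-resp (⁻¹-cong e)) s

    adj-resp : ∀ {x y x′ y′} → x ≈ x′ → y ≈ y′ → Adj x y → Adj x′ y′
    adj-resp x≈x′ y≈y′ = adj-transport
      (λ x′≈y′ → trans x≈x′ (trans x′≈y′ (sym y≈y′))) (\\-cong₂ x≈x′ y≈y′)

    adj-sym : ∀ {x y} → Adj x y → Adj y x
    adj-sym {x} {y} (x≉y , s) = x≉y ∘ sym ,
      Sum.swap (Sum.map (S-resp (sym (⁻¹-anti-homo-\\ y x))) (S-resp (⁻¹-anti-homo-\\ x y)) s)

    adj-translate : ∀ g {x y} → Adj x y → Adj (g ∙ x) (g ∙ y)
    adj-translate g {x} {y} =
      adj-transport (∙-cancelˡ g x y) (sym ([gx]\\[gy]≈x\\y g x y))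

    walk-resp : ∀ {x y x′ y′ j} → x ≈ x′ → y ≈ y′ → Walk x y j → Walk x′ y′ j
    walk-resp x≈x′ y≈y′ (w-nil x≈y)  = w-nil (trans (sym x≈x′) (trans x≈y y≈y′))
    walk-resp x≈x′ y≈y′ (w-cons a w) = w-cons (adj-resp x≈x′ refl a) (walk-resp refl y≈y′ w)

    walk-++ : ∀ {x y z j k} → Walk x y j → Walk y z k → Walk x z (j + k)
    walk-++ (w-nil x≈y)  w′ = walk-resp (sym x≈y) refl w′
    walk-++ (w-cons a w) w′ = w-cons a (walk-++ w w′)

    walk-reverse : ∀ {x y j} → Walk x y j → Walk y x j
    walk-reverse {j = j} w = ≡.subst (Walk _ _) (ℕ.+-identityʳ j) (reverse-onto w (w-nil refl))
      where
      reverse-onto : ∀ {x y z j k} → Walk x y j → Walk x z k → Walk y z (j + k)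
      reverse-onto (w-nil x≈y) acc = walk-resp x≈y refl acc
      reverse-onto {z = z} {j = suc j} {k} (w-cons a w) acc =
        ≡.subst (Walk _ z) (ℕ.+-suc j k) (reverse-onto w (w-cons (adj-sym a) acc))

    walk-translate : ∀ g {x y j} → Walk x y j → Walk (g ∙ x) (g ∙ y) j
    walk-translate g (w-nil x≈y)  = w-nil (∙-congˡ x≈y)
    walk-translate g (w-cons a w) = w-cons (adj-translate g a) (walk-translate g w)

    walk₁⇒adj : ∀ {x y} → Walk x y 1 → Adj x y
    walk₁⇒adj (w-cons a (w-nil y≈z)) = adj-resp refl y≈z a

    dist-resp : ∀ {x y x′ y′ k} → x ≈ x′ → y ≈ y′ → Dist x y k → Dist x′ y′ k
    dist-resp x≈x′ y≈y′ (w , shortest) =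
      walk-resp x≈x′ y≈y′ w , λ j w′ → shortest j (walk-resp (sym x≈x′) (sym y≈y′) w′)

    dist-sym : ∀ {x y k} → Dist x y k → Dist y x k
    dist-sym (w , shortest) = walk-reverse w , λ j w′ → shortest j (walk-reverse w′)

    -- u is a product of n letters from S ∪ S⁻¹, none of them ≈ ε.
    Word : Carrier → ℕ → Set _
    Word u n = ∀ z → Walk z (z ∙ u) n

    word-∙ : ∀ {u v m n} → Word u m → Word v n → Word (u ∙ v) (m + n)
    word-∙ wu wv z = walk-resp refl (assoc _ _ _) (walk-++ (wu z) (wv (z ∙ _)))

    word-∏ : ∀ {u} → (∀ i → Word (u i) 1) → ∀ k → Word (∏ u k) k
    word-∏ wu zero    z = w-nil (sym (identityʳ z))
    word-∏ wu (suc k)   = word-∙ (wu 0) (word-∏ (wu ∘ suc) k)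

    walk⇒word : ∀ {x s j} → Walk x (x ∙ s) j → Word s j
    walk⇒word {x} {s} w z = walk-resp (//-rightDividesˡ x z) z/x∙[x∙s]≈z∙s (walk-translate (z // x) w)
      where
      z/x∙[x∙s]≈z∙s : (z // x) ∙ (x ∙ s) ≈ z ∙ s
      z/x∙[x∙s]≈z∙s = trans (assoc z (x ⁻¹) (x ∙ s)) (∙-congˡ (\\-leftDividesʳ x s))

    adj⇒word : ∀ {x y} → Adj x y → Word (x \\ y) 1
    adj⇒word {x} {y} a = walk⇒word (w-cons (adj-resp refl (sym (\\-leftDividesˡ x y)) a) (w-nil refl))

    -- A shorter path y ⇝ y ∙ s, translated to start at x and followed by r,
    -- would beat the geodesic x ⇝ x ∙ (s ∙ r).
    factor-geodesic : ∀ {s r c k x} → Word s c → Word r k →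
                      Dist x (x ∙ (s ∙ r)) (c + k) → ∀ y → Dist y (y ∙ s) c
    factor-geodesic {s} {r} {c} {k} {x} ws wr (_ , shortest) y = ws y , minimal
      where
      minimal : ∀ j → Walk y (y ∙ s) j → c ℕ.≤ j
      minimal j w = ℕ.+-cancelʳ-≤ k c j (shortest (j + k)
        (walk-resp refl (assoc x s r) (walk-++ (walk⇒word w x) (wr (x ∙ s)))))

    module FromRay (κ : ℕ → Carrier) (ray : GeodesicRay κ) where
      d : ℕ → Carrier
      d = increments κ

      ∏-word : ∀ f k → Word (∏ (d ∘ f) k) k
      ∏-word f = word-∏ (λ i → adj⇒word (proj₁ ray (f i)))

      E O : ℕ → Carrier
      E = ∏ (d ∘ twice)
      O = ∏ (d ∘ suc ∘ twice)

      E∙O-geodesic : ∀ N → Dist (κ 0) (κ 0 ∙ (E N ∙ O N)) (N + N)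
      E∙O-geodesic N =
        ≡.subst (Dist _ _) (twice≡+ N) (dist-resp refl κ[2N]≈κ0∙E∙O (proj₂ ray 0 (twice N)))
        where
        κ[2N]≈κ0∙E∙O : κ (twice N) ≈ κ 0 ∙ (E N ∙ O N)
        κ[2N]≈κ0∙E∙O = sym (trans (∙-congˡ (sym (∏-interleave d N))) (∏-increments κ (twice N)))

      window-geodesic : ∀ {s r c k} N → Word s c → Word r k →
                        s ∙ r ≈ E N ∙ O N → c + k ≡ N + N → ∀ y → Dist y (y ∙ s) c
      window-geodesic N ws wr s∙r≈E∙O c+k≡N+N = factor-geodesic ws wr
        (≡.subst (Dist _ _) (≡.sym c+k≡N+N) (dist-resp refl (∙-congˡ (sym s∙r≈E∙O)) (E∙O-geodesic N)))

      E-geodesic : ∀ a k → Dist (E a) (E (a + k)) k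
      E-geodesic a k = dist-resp refl (sym (∏-+ (d ∘ twice) a k))
        (window-geodesic (a + k) (∏-word (twice ∘ (a +_)) k)
          (word-∙ (∏-word twice a) (∏-word (suc ∘ twice) (a + k)))
          (trans (x∙yz≈yx∙z _ _ _) (∙-congʳ (sym (∏-+ (d ∘ twice) a k))))
          (k+[a+[a+k]]≡[a+k]+[a+k] a k) (E a))

      O-geodesic : ∀ a k → Dist (O (a + k) ⁻¹) (O a ⁻¹) k
      O-geodesic a k = dist-resp refl O[a+k]⁻¹∙s≈O[a]⁻¹
        (window-geodesic (a + k) (∏-word (suc ∘ twice ∘ (a +_)) k)
          (word-∙ (∏-word twice (a + k)) (∏-word (suc ∘ twice) a))
          (trans (x∙yz≈y∙zx _ _ _) (∙-congˡ (sym (∏-+ (d ∘ suc ∘ twice) a k))))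
          (k+[[a+k]+a]≡[a+k]+[a+k] a k) (O (a + k) ⁻¹))
        where
        O[a+k]⁻¹∙s≈O[a]⁻¹ : O (a + k) ⁻¹ ∙ ∏ (d ∘ suc ∘ twice ∘ (a +_)) k ≈ O a ⁻¹
        O[a+k]⁻¹∙s≈O[a]⁻¹ = trans (∙-congʳ (⁻¹-cong (∏-+ (d ∘ suc ∘ twice) a k))) ([xy]⁻¹∙y≈x⁻¹ _ _)

      O⁻¹E-geodesic : ∀ a n → Dist (O a ⁻¹) (E n) (n + a)
      O⁻¹E-geodesic a n = dist-resp refl (trans (∙-congˡ (comm _ _)) (\\-leftDividesʳ (O a) (E n)))
        (window-geodesic (n + a) (word-∙ (∏-word twice n) (∏-word (suc ∘ twice) a))
          (word-∙ (∏-word (twice ∘ (n +_)) a) (∏-word (suc ∘ twice ∘ (a +_)) n))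
          (begin
            (E n ∙ O a) ∙ (∏ (d ∘ twice ∘ (n +_)) a ∙ ∏ (d ∘ suc ∘ twice ∘ (a +_)) n)
              ≈⟨ interchange _ _ _ _ ⟩
            (E n ∙ ∏ (d ∘ twice ∘ (n +_)) a) ∙ (O a ∙ ∏ (d ∘ suc ∘ twice ∘ (a +_)) n)
              ≈⟨ ∙-cong (∏-+ (d ∘ twice) n a) (∏-+ (d ∘ suc ∘ twice) a n) ⟨
            E (n + a) ∙ O (a + n)
              ≡⟨ ≡.cong (λ m → E (n + a) ∙ O m) (ℕ.+-comm a n) ⟩
            E (n + a) ∙ O (n + a) ∎)
          (≡.cong ((n + a) +_) (ℕ.+-comm a n)) (O a ⁻¹))

      η : ℤ → Carrier
      η (ℤ.+ n)    = E n
      η -[1+ p ]   = O (suc p) ⁻¹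

      η-geodesic-≤ : ∀ {i j} → i ℤ.≤ j → Dist (η i) (η j) ℤ.∣ j ℤ.- i ∣
      η-geodesic-≤ {ℤ.+ a} (+≤+ a≤b) with k , ≡.refl ← ℕ.m≤n⇒∃[o]m+o≡n a≤b =
        ≡.subst (Dist _ _) (≡.sym (∣+[m+n]-+m∣≡n a k)) (E-geodesic a k)
      η-geodesic-≤ {j = -[1+ q ]} (-≤- q≤p) with k , ≡.refl ← ℕ.m≤n⇒∃[o]m+o≡n q≤p =
        ≡.subst (Dist _ _) (≡.sym (∣-[1+m]--[1+m+n]∣≡n q k)) (O-geodesic (suc q) k)
      η-geodesic-≤ { -[1+ p ]} {ℤ.+ n} -≤+ = O⁻¹E-geodesic (suc p) n

      η-geodesic : ∀ i j → Dist (η i) (η j) ℤ.∣ i ℤ.- j ∣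
      η-geodesic i j with ℤ.≤-total i j
      ... | inj₁ i≤j = ≡.subst (Dist _ _) (ℤ.∣i-j∣≡∣j-i∣ j i) (η-geodesic-≤ i≤j)
      ... | inj₂ j≤i = dist-sym (η-geodesic-≤ j≤i)

      η-adjacent : ∀ i → Adj (η i) (η (i ℤ.+ ℤ.1ℤ))
      η-adjacent i = walk₁⇒adj
        (≡.subst (Walk _ _) (≡.cong ℤ.∣_∣ (i-[i+1]≡-1 i)) (proj₁ (η-geodesic i (i ℤ.+ ℤ.1ℤ))))

      η-biInfiniteGeodesic : BiInfiniteGeodesic η
      η-biInfiniteGeodesic = η-adjacent , η-geodesic

mainTheorem4 : {c ℓ p : Level} (G : AbelianGroup c ℓ)
    (S : AbelianGroup.Carrier G → Set p) →
    Cayley.Generating G S →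
    Σ (ℕ → AbelianGroup.Carrier G) (Cayley.GeodesicRay G S) →
    Σ (ℤ → AbelianGroup.Carrier G) (Cayley.BiInfiniteGeodesic G S)
mainTheorem4 G S (S-resp , _) (κ , ray) = η , η-biInfiniteGeodesic
  where open Abelian.CayleyGraph.FromRay G S S-resp κ ray
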